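{- For every finite set of Wang tiles $\mathcal{W}$: if $\mathcal{W}$ tiles $\mathbb{Z}^2$, then $\psi_{\mathcal{W}}\notin\mathrm{Log}(\mathcal{P}_{\mathrm{fin}}(\mathbb{N}),\cup,\varnothing)$, i.e. there is a valuation $V:\mathsf{Prop}\to\mathcal{P}(\mathcal{P}_{\mathrm{fin}}(\mathbb{N}))$ under which $\varnothing\nVdash\psi_{\mathcal{W}}$.
   Context: Formulas are built from a countably infinite set $\mathsf{Prop}$ of letters by $\land,\lor,\to$ ($\land,\lor$ bind tighter than $\to$). On finite subsets of $\mathbb{N}$ with valuation $V$: $x\Vdash p$ iff $x\in V(p)$; $\land,\lor$ pointwise; $x\Vdash\varphi\to\psi$ iff for every finite $y\subseteq\mathbb{N}$ with $y\Vdash\varphi$, $x\cup y\Vdash\psi$. $\mathrm{Log}(\mathcal{P}_{\mathrm{fin}}(\mathbb{N}),\cup,\varnothing)$ is the set of formulas satisfied at $\varnothing$ under every valuation. A Wang tile is $t=(t_W,t_E,t_N,t_S)\in\mathbb{N}^4$; $\mathcal{W}$ tiles $\mathbb{Z}^2$ if there is $\tau:\mathbb{Z}^2\to\mathcal{W}$ with $\tau_E(m,n)=\tau_W(m+1,n)$ and $\tau_N(m,n)=\tau_S(m,n+1)$ for all $m,n$. The formula $\psi_{\mathcal{W}}$: take distinct letters $\mathtt{t}$ ($t\in\mathcal{W}$), $\mathtt{x},\mathtt{y},\mathtt{p}_\top$, $\mathtt{m}_{i,j}$ ($i,j\in\{0,1\}$). Let $\mathtt{R}(t)=\bigvee_{t'\in\mathcal{W},\,t_E=t'_W}\mathtt{t}'$,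 $\mathtt{U}(t)=\bigvee_{t'\in\mathcal{W},\,t_N=t'_S}\mathtt{t}'$; $\mathtt{G}_{i,j}=\mathtt{m}_{i,j}\land\bigvee_{t\in\mathcal{W}}[\mathtt{t}\land(\mathtt{y}\to(\mathtt{m}_{i,j}\lor(\mathtt{m}_{i,1-j}\land\mathtt{U}(t))))]$; $\mathtt{x}'=\mathtt{x}\land\mathtt{p}_\top\land(\mathtt{p}_\top\to\mathtt{p}_\top)\land\bigwedge_{t\in\mathcal{W},i,j}[(\mathtt{m}_{i,j}\land\mathtt{t})\to(\mathtt{m}_{i,j}\lor(\mathtt{m}_{1-i,j}\land\mathtt{R}(t)))]\land\bigwedge_{(i,j)\ne(i',j')}[(\mathtt{m}_{i,j}\land\mathtt{m}_{i',j'})\to(\mathtt{m}_{0,0}\land\mathtt{m}_{0,1})]\land\bigwedge_{t\ne t'}[(\mathtt{t}\land\mathtt{t}')\to(\mathtt{m}_{0,0}\land\mathtt{m}_{0,1})]$; $\mathtt{y}'=\mathtt{y}\land\mathtt{p}_\top\land(\mathtt{p}_\top\to\mathtt{p}_\top)$; $\mathtt{m}^c_{i,j}=\mathtt{m}_{i,1-j}\lor\mathtt{m}_{1-i,j}\lor\mathtt{m}_{1-i,1-j}$; $\alpha=\bigwedge_{i,j}(\mathtt{m}^c_{i,j}\to\mathtt{m}^c_{i,j})$; $\beta_1=\bigwedge_{i\in\{0,1\}}[(\mathtt{y}'\to\mathtt{m}^c_{i,i})\to\mathtt{m}^c_{i,1-i}]$; $\beta_2=\bigwedge_{i\in\{0,1\}}[(\mathtt{x}'\to\mathtt{m}^c_{1-i,i})\to\mathtt{m}^c_{i,i}]$;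 $\gamma=\mathtt{p}_\top\to\bigvee_{i,j}\mathtt{G}_{i,j}$; $\psi_{\mathcal{W}}=(\alpha\land\beta_1\land\beta_2\land\gamma\land\mathtt{G}_{0,0})\to(\mathtt{x}'\to\mathtt{m}^c_{1,0})$. -}

module Defs where

open import Data.Nat using (ℕ; suc; _+_; _≟_)
open import Data.Bool using (Bool; true; false; not; if_then_else_; _xor_) renaming (_∨_ to _||_)
open import Data.Fin using (Fin; toℕ) renaming (_≟_ to _≟ᶠ_)
open import Data.List using (List; []; _∷_; _++_; map; concatMap; filter; length; lookup; allFin)
open import Data.Product using (_×_; _,_)
open import Data.Sum using (_⊎_)
open import Data.Integer using (ℤ) renaming (_+_ to _+ℤ_; 1ℤ to 1ℤ)
open import Relation.Nullary using (does)
open import Relation.Binary.PropositionalEquality using (_≡_)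

-- A nonempty finite set is a little-endian bit string whose last bit is 1:
--   end      = {0}
--   b ∷ s    = (if b then {0} else ∅) ∪ { k+1 | k ∈ s }
-- Every finite subset of ℕ has exactly one representation.

data NE : Set where
  end : NE
  _∷_ : Bool → NE → NE

data FinSet : Set where
  ∅  : FinSet
  ne : NE → FinSet

_∈ᴺ_ : ℕ → NE → Set
0     ∈ᴺ end     = Data.Bool.T true where import Data.Bool
suc k ∈ᴺ end     = Data.Bool.T false where import Data.Bool
0     ∈ᴺ (b ∷ s) = Data.Bool.T b where import Data.Bool
suc k ∈ᴺ (b ∷ s) = k ∈ᴺ s

_∈_ : ℕ → FinSet → Set
k ∈ ∅    = Data.Bool.T false where import Data.Bool
k ∈ ne s = k ∈ᴺ s

_∪ᴺ_ : NE → NE → NE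
end     ∪ᴺ end     = end
end     ∪ᴺ (b ∷ s) = true ∷ s
(b ∷ s) ∪ᴺ end     = true ∷ s
(b ∷ s) ∪ᴺ (c ∷ t) = (b || c) ∷ (s ∪ᴺ t)

_∪_ : FinSet → FinSet → FinSet
∅    ∪ y    = y
ne s ∪ ∅    = ne s
ne s ∪ ne t = ne (s ∪ᴺ t)

infixr 7 _∧ᶠ_
infixr 6 _∨ᶠ_
infixr 5 _⇒_

data Form : Set where
  var   : ℕ → Form
  _∧ᶠ_  : Form → Form → Form
  _∨ᶠ_  : Form → Form → Form
  _⇒_   : Form → Form → Form

Valuation : Set₁
Valuation = ℕ → FinSet → Set

infix 2 _⊨_⊩_
_⊨_⊩_ : Valuation → FinSet → Form → Set
V ⊨ x ⊩ var p   = V p x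
V ⊨ x ⊩ φ ∧ᶠ ψ  = (V ⊨ x ⊩ φ) × (V ⊨ x ⊩ ψ)
V ⊨ x ⊩ φ ∨ᶠ ψ  = (V ⊨ x ⊩ φ) ⊎ (V ⊨ x ⊩ ψ)
V ⊨ x ⊩ φ ⇒ ψ   = (y : FinSet) → V ⊨ y ⊩ φ → V ⊨ (x ∪ y) ⊩ ψ

InLog : Form → Set₁
InLog φ = (V : Valuation) → V ⊨ ∅ ⊩ φ

record Tile : Set where
  constructor tile
  field
    tW tE tN tS : ℕ
open Tile public

-- a finite set of tiles is a duplicate-free list (uniqueness is imposed
-- in the statement); τ picks an index into the list.
Tiles : List Tile → Set
Tiles 𝒲 = Data.Product.Σ (ℤ → ℤ → Fin (length 𝒲)) λ τ →
  (∀ m n → tE (lookup 𝒲 (τ m n)) ≡ tW (lookup 𝒲 (τ (m +ℤ 1ℤ) n))) ×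
  (∀ m n → tN (lookup 𝒲 (τ m n)) ≡ tS (lookup 𝒲 (τ m (n +ℤ 1ℤ))))
  where import Data.Product

_∧*_ : Form → List Form → Form
A ∧* []      = A
A ∧* (B ∷ L) = A ∧ᶠ (B ∧* L)

_∨*_ : Form → List Form → Form
A ∨* []      = A
A ∨* (B ∷ L) = A ∨ᶠ (B ∨* L)

-- A ∨ (B ∧ ⋁ L), where the empty disjunction is ⊥, so that for L = [] the
-- formula is (semantically exactly) A.
orAnd : Form → Form → List Form → Form
orAnd A B []      = A
orAnd A B (C ∷ L) = A ∨ᶠ (B ∧ᶠ (C ∨* L))

-- ⋁ over a list; the value on [] is an arbitrary placeholder, it is only
-- used for ⋁_{t∈𝒲} with 𝒲 = [], which cannot tile ℤ².
⋁ : List Form → Form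
⋁ []      = var 0
⋁ (C ∷ L) = C ∨* L

-- The formula ψ_𝒲.  Letters: x = 0, y = 1, p_⊤ = 2,
-- m_{i,j} = 3 + 2i + j  (0 ↔ false, 1 ↔ true), tile number k of 𝒲 ↦ 7 + k.

bits : List (Bool × Bool)
bits = (false , false) ∷ (false , true) ∷ (true , false) ∷ (true , true) ∷ []

mIdx : Bool → Bool → ℕ
mIdx false false = 3
mIdx false true  = 4
mIdx true  false = 5
mIdx true  true  = 6

module Psi (𝒲 : List Tile) where

  idx : List (Fin (length 𝒲))
  idx = allFin (length 𝒲)

  T : Fin (length 𝒲) → Tile
  T = lookup 𝒲

  tl : Fin (length 𝒲) → Form
  tl k = var (7 + toℕ k)

  x y p⊤ : Form
  x  = var 0
  y  = var 1
  p⊤ = var 2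

  m : Bool → Bool → Form
  m i j = var (mIdx i j)

  R U : Fin (length 𝒲) → List Form
  R k = map tl (filter (λ k' → tE (T k) ≟ tW (T k')) idx)
  U k = map tl (filter (λ k' → tN (T k) ≟ tS (T k')) idx)

  G : Bool → Bool → Form
  G i j = m i j ∧ᶠ ⋁ (map (λ k → tl k ∧ᶠ (y ⇒ orAnd (m i j) (m i (not j)) (U k))) idx)

  A1 A2 A3 : List Form
  A1 = concatMap (λ k → map (λ { (i , j) →
         (m i j ∧ᶠ tl k) ⇒ orAnd (m i j) (m (not i) j) (R k) }) bits) idx
  A2 = concatMap (λ { (i , j) → concatMap (λ { (i' , j') →
         if (i xor i') || (j xor j')
         then ((m i j ∧ᶠ m i' j') ⇒ (m false false ∧ᶠ m false true)) ∷ []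
         else [] }) bits }) bits
  A3 = concatMap (λ k → concatMap (λ k' →
         if does (k ≟ᶠ k') then []
         else ((tl k ∧ᶠ tl k') ⇒ (m false false ∧ᶠ m false true)) ∷ []) idx) idx

  x' y' : Form
  x' = x ∧* (p⊤ ∷ (p⊤ ⇒ p⊤) ∷ (A1 ++ A2 ++ A3))
  y' = y ∧* (p⊤ ∷ (p⊤ ⇒ p⊤) ∷ [])

  mc : Bool → Bool → Form
  mc i j = m i (not j) ∨ᶠ m (not i) j ∨ᶠ m (not i) (not j)

  α β₁ β₂ γ ψ : Form
  α  = (mc false false ⇒ mc false false) ∧* map (λ { (i , j) → mc i j ⇒ mc i j })
         ((false , true) ∷ (true , false) ∷ (true , true) ∷ [])
  β₁ = ((y' ⇒ mc false false) ⇒ mc false true) ∧ᶠ ((y' ⇒ mc true true) ⇒ mc true false)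
  β₂ = ((x' ⇒ mc true false) ⇒ mc false false) ∧ᶠ ((x' ⇒ mc false true) ⇒ mc true true)
  γ  = p⊤ ⇒ (G false false ∨ᶠ G false true ∨ᶠ G true false ∨ᶠ G true true)
  ψ  = (α ∧ᶠ β₁ ∧ᶠ β₂ ∧ᶠ γ ∧ᶠ G false false) ⇒ (x' ⇒ mc true false)

ψ[_] : List Tile → Form
ψ[ 𝒲 ] = Psi.ψ 𝒲

module Submission where

-- Send a finite set w ⊆ ℕ to the cell (number of even elements, number of odd elements)
-- of ℕ². Let x hold at the even singletons, y at the odd ones, m_{i,j} at the sets whose
-- cell has parities (i, j), and the letter of a tile at the sets whose cell carries that
-- tile in the given tiling, restricted to the quadrant ℕ². Joining {k} to w either leaves
-- w unchanged or moves its cell one step right (k even) or up (k odd); this makes the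
-- implications inside x' and G true, with the matching conditions of the tiling supplying
-- the neighbour tiles in R and U. Since a fresh element of either parity always exists,
-- the parity of a cell can always be toggled, which gives β₁ and β₂. Hence the antecedent
-- of ψ holds at ∅, whereas {0} forces x' and lies in the cell (1, 0), where mc_{1,0} fails.

open import Defs
open import Data.Bool using (Bool; true; false; not; _∨_; _xor_; if_then_else_)
open import Data.Bool.Properties using (∨-comm; not-involutive; not-¬; ¬-not; xor-same) renaming (_≟_ to _≟ᵇ_)
open import Data.Fin using (Fin; toℕ) renaming (_≟_ to _≟ᶠ_)
open import Data.Fin.Properties using (toℕ-injective)
open import Data.Integer using (+_)
open import Data.List using (List; []; _∷_; _++_; concatMap; length; lookup)
open import Data.List.Membership.Propositional using (lose)
open import Data.List.Membership.Propositional.Properties using (∈-map⁺; ∈-filter⁺; ∈-allFin)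
open import Data.List.Relation.Unary.All using (All; []; _∷_; universal)
open import Data.List.Relation.Unary.All.Properties using (++⁺; concat⁺; map⁺)
open import Data.List.Relation.Unary.Any using (Any; here; there)
open import Data.List.Relation.Unary.Unique.Propositional using (Unique)
open import Data.Nat using (ℕ; zero; suc; _≟_)
open import Data.Nat.Properties using (+-comm)
open import Data.Product using (Σ; ∃-syntax; _×_; _,_; proj₁; proj₂; uncurry)
open import Data.Product.Properties using (,-injectiveˡ; ,-injectiveʳ; ≡-dec)
open import Data.Sum using (_⊎_; inj₁; inj₂)
import Data.Sum as Sum
open import Data.Unit using (⊤; tt)
open import Function using (_∘_)
open import Relation.Binary.PropositionalEquality
  using (_≡_; _≢_; refl; sym; trans; cong; cong₂; subst; subst₂; module ≡-Reasoning)
open import Relation.Nullary using (¬_; Dec; does; yes; no; contradiction)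

isOdd : ℕ → Bool
isOdd zero    = false
isOdd (suc k) = not (isOdd k)

singletonᴺ : ℕ → NE
singletonᴺ zero    = end
singletonᴺ (suc k) = false ∷ singletonᴺ k

⁅_⁆ : ℕ → FinSet
⁅ k ⁆ = ne (singletonᴺ k)

∪ᴺ-comm : ∀ s t → s ∪ᴺ t ≡ t ∪ᴺ s
∪ᴺ-comm end     end     = refl
∪ᴺ-comm end     (b ∷ t) = refl
∪ᴺ-comm (b ∷ s) end     = refl
∪ᴺ-comm (b ∷ s) (c ∷ t) = cong₂ _∷_ (∨-comm b c) (∪ᴺ-comm s t)

∪-comm : ∀ u w → u ∪ w ≡ w ∪ u
∪-comm ∅      ∅      = refl
∪-comm ∅      (ne t) = refl
∪-comm (ne s) ∅      = refl
∪-comm (ne s) (ne t) = cong ne (∪ᴺ-comm s t)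

-- cellᴺ s = (number of even elements, number of odd elements) of s; prepending a bit
-- shifts every element up by one, which swaps the two counts.
shift : Bool → ℕ × ℕ → ℕ × ℕ
shift true  (e , o) = suc o , e
shift false (e , o) = o , e

cellᴺ : NE → ℕ × ℕ
cellᴺ end     = 1 , 0
cellᴺ (b ∷ s) = shift b (cellᴺ s)

cell : FinSet → ℕ × ℕ
cell ∅      = 0 , 0
cell (ne s) = cellᴺ s

step : Bool → ℕ × ℕ → ℕ × ℕ
step false (a , b) = suc a , b
step true  (a , b) = a , suc b

shift-step : ∀ b a c → shift b (step a c) ≡ step (not a) (shift b c)
shift-step true  true  c = refl
shift-step true  false c = refl
shift-step false true  c = refl
shift-step false false c = refl

cellᴺ-singletonᴺ : ∀ k → cellᴺ (singletonᴺ k) ≡ step (isOdd k) (0 , 0)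
cellᴺ-singletonᴺ zero    = refl
cellᴺ-singletonᴺ (suc k) =
  trans (cong (shift false) (cellᴺ-singletonᴺ k)) (shift-step false (isOdd k) (0 , 0))

singletonᴺ-∪ᴺ : ∀ k s → singletonᴺ k ∪ᴺ s ≡ s ⊎ cellᴺ (singletonᴺ k ∪ᴺ s) ≡ step (isOdd k) (cellᴺ s)
singletonᴺ-∪ᴺ zero    end         = inj₁ refl
singletonᴺ-∪ᴺ zero    (true ∷ s)  = inj₁ refl
singletonᴺ-∪ᴺ zero    (false ∷ s) = inj₂ refl
singletonᴺ-∪ᴺ (suc k) end         =
  inj₂ (trans (cong (shift true) (cellᴺ-singletonᴺ k)) (shift-step true (isOdd k) (0 , 0)))
singletonᴺ-∪ᴺ (suc k) (c ∷ s) with singletonᴺ-∪ᴺ k s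
... | inj₁ same  = inj₁ (cong (c ∷_) same)
... | inj₂ moved = inj₂ (trans (cong (shift c) moved) (shift-step c (isOdd k) (cellᴺ s)))

Moves : Bool → FinSet → FinSet → Set
Moves a w v = v ≡ w ⊎ cell v ≡ step a (cell w)

⁅⁆-∪-moves : ∀ k w → Moves (isOdd k) w (⁅ k ⁆ ∪ w)
⁅⁆-∪-moves k ∅      = inj₂ (cellᴺ-singletonᴺ k)
⁅⁆-∪-moves k (ne s) = Sum.map₁ (cong ne) (singletonᴺ-∪ᴺ k s)

-- The witness lies beyond every element of s.
fresh-singletonᴺ : ∀ a s → ∃[ k ] isOdd k ≡ a × cellᴺ (singletonᴺ k ∪ᴺ s) ≡ step (isOdd k) (cellᴺ s)
fresh-singletonᴺ false end = 2 , refl , refl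
fresh-singletonᴺ true  end = 1 , refl , refl
fresh-singletonᴺ a (c ∷ s) with fresh-singletonᴺ (not a) s
... | k , odd , moved =
  suc k , trans (cong not odd) (not-involutive a) ,
  trans (cong (shift c) moved) (shift-step c (isOdd k) (cellᴺ s))

fresh-singleton : ∀ a w → ∃[ k ] isOdd k ≡ a × cell (w ∪ ⁅ k ⁆) ≡ step a (cell w)
fresh-singleton false ∅      = 0 , refl , refl
fresh-singleton true  ∅      = 1 , refl , refl
fresh-singleton a     (ne s) with fresh-singletonᴺ a s
... | k , refl , moved = k , refl , trans (cong cellᴺ (∪ᴺ-comm s (singletonᴺ k))) moved

parity : ℕ × ℕ → Bool × Bool
parity (a , b) = isOdd a , isOdd b

toggle : Bool → Bool × Bool → Bool × Bool
toggle false (i , j) = not i , j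
toggle true  (i , j) = i , not j

parity-step : ∀ a c → parity (step a c) ≡ toggle a (parity c)
parity-step false c = refl
parity-step true  c = refl

≢-complement : ∀ {c : Bool × Bool} {i j} → c ≢ (i , j) →
  c ≡ (i , not j) ⊎ c ≡ (not i , j) ⊎ c ≡ (not i , not j)
≢-complement {a , b} {i} {j} c≢ij with a ≟ᵇ i | b ≟ᵇ j
... | yes refl | yes refl = contradiction refl c≢ij
... | yes refl | no b≢j  = inj₁ (cong (a ,_) (¬-not b≢j))
... | no a≢i  | yes refl = inj₂ (inj₁ (cong (_, b) (¬-not a≢i)))
... | no a≢i  | no b≢j  = inj₂ (inj₂ (cong₂ _,_ (¬-not a≢i) (¬-not b≢j)))

xor-distinct : ∀ {i j i' j'} → (i xor i') ∨ (j xor j') ≡ true → (i , j) ≢ (i' , j')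
xor-distinct {i} {j} guard refl =
  contradiction (trans (sym guard) (cong₂ _∨_ (xor-same i) (xor-same j))) λ ()

record QuadrantTiling (𝒲 : List Tile) : Set where
  field
    tileAt : ℕ → ℕ → Fin (length 𝒲)
    east   : ∀ a b → tE (lookup 𝒲 (tileAt a b)) ≡ tW (lookup 𝒲 (tileAt (suc a) b))
    north  : ∀ a b → tN (lookup 𝒲 (tileAt a b)) ≡ tS (lookup 𝒲 (tileAt a (suc b)))

restrictToQuadrant : ∀ {𝒲} → Tiles 𝒲 → QuadrantTiling 𝒲
restrictToQuadrant {𝒲} (τ , east , north) = record
  { tileAt = λ a b → τ (+ a) (+ b)
  ; east   = λ a b → subst (λ m → tE (T (τ (+ a) (+ b))) ≡ tW (T (τ m (+ b))))
                           (cong +_ (+-comm a 1)) (east (+ a) (+ b))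
  ; north  = λ a b → subst (λ n → tN (T (τ (+ a) (+ b))) ≡ tS (T (τ (+ a) n)))
                           (cong +_ (+-comm b 1)) (north (+ a) (+ b))
  }
  where T = lookup 𝒲

module _ {V : Valuation} {w : FinSet} where

  ∧*-intro : ∀ {A} L → V ⊨ w ⊩ A → All (V ⊨ w ⊩_) L → V ⊨ w ⊩ A ∧* L
  ∧*-intro []      ⊩A []         = ⊩A
  ∧*-intro (B ∷ L) ⊩A (⊩B ∷ ⊩L) = ⊩A , ∧*-intro L ⊩B ⊩L

  ⋁-intro : ∀ L → Any (V ⊨ w ⊩_) L → V ⊨ w ⊩ ⋁ L
  ⋁-intro (C ∷ [])    (here ⊩C)  = ⊩C
  ⋁-intro (C ∷ D ∷ L) (here ⊩C)  = inj₁ ⊩C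
  ⋁-intro (C ∷ D ∷ L) (there ⊩L) = inj₂ (⋁-intro (D ∷ L) ⊩L)

  orAnd-introˡ : ∀ {A B} L → V ⊨ w ⊩ A → V ⊨ w ⊩ orAnd A B L
  orAnd-introˡ []      ⊩A = ⊩A
  orAnd-introˡ (C ∷ L) ⊩A = inj₁ ⊩A

  orAnd-introʳ : ∀ {A B} L → V ⊨ w ⊩ B → Any (V ⊨ w ⊩_) L → V ⊨ w ⊩ orAnd A B L
  orAnd-introʳ (C ∷ L) ⊩B ⊩L = inj₂ (⊩B , ⋁-intro (C ∷ L) ⊩L)

concatMap⁺ : ∀ {A : Set} {P : Form → Set} (f : A → List Form) {xs} →
             All (All P ∘ f) xs → All P (concatMap f xs)
concatMap⁺ f = concat⁺ ∘ map⁺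

if-[]⁺ : ∀ {P : Form → Set} b {φ} → (b ≡ true → P φ) → All P (if b then φ ∷ [] else [])
if-[]⁺ true  Pφ = Pφ refl ∷ []
if-[]⁺ false Pφ = []

if-does-[]⁺ : ∀ {A : Set} {P : Form → Set} (a? : Dec A) {φ} → (¬ A → P φ) →
              All P (if does a? then [] else φ ∷ [])
if-does-[]⁺ (yes _) Pφ = []
if-does-[]⁺ (no ¬a) Pφ = Pφ ¬a ∷ []

module Countermodel (𝒲 : List Tile) (σ : QuadrantTiling 𝒲) where
  open Psi 𝒲
  open QuadrantTiling σ

  tileOf : FinSet → Fin (length 𝒲)
  tileOf w = uncurry tileAt (cell w)

  V : Valuation
  V 0 w = ∃[ k ] isOdd k ≡ false × w ≡ ⁅ k ⁆
  V 1 w = ∃[ k ] isOdd k ≡ true × w ≡ ⁅ k ⁆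
  V 2 w = ⊤
  V 3 w = parity (cell w) ≡ (false , false)
  V 4 w = parity (cell w) ≡ (false , true)
  V 5 w = parity (cell w) ≡ (true , false)
  V 6 w = parity (cell w) ≡ (true , true)
  V (suc (suc (suc (suc (suc (suc (suc n))))))) w = toℕ (tileOf w) ≡ n

  infix 3 _⊩_
  _⊩_ : FinSet → Form → Set
  w ⊩ φ = V ⊨ w ⊩ φ

  m⟨_⟩ mc⟨_⟩ G⟨_⟩ : Bool × Bool → Form
  m⟨ i , j ⟩  = m i j
  mc⟨ i , j ⟩ = mc i j
  G⟨ i , j ⟩  = G i j

  m⁺ : ∀ {w} c → parity (cell w) ≡ c → w ⊩ m⟨ c ⟩
  m⁺ (false , false) p = p
  m⁺ (false , true)  p = p
  m⁺ (true  , false) p = p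
  m⁺ (true  , true)  p = p

  m⁻ : ∀ {w} c → w ⊩ m⟨ c ⟩ → parity (cell w) ≡ c
  m⁻ (false , false) p = p
  m⁻ (false , true)  p = p
  m⁻ (true  , false) p = p
  m⁻ (true  , true)  p = p

  mc⁺ : ∀ {w} c → parity (cell w) ≢ c → w ⊩ mc⟨ c ⟩
  mc⁺ (i , j) p≢c =
    Sum.map (m⁺ (i , not j)) (Sum.map (m⁺ (not i , j)) (m⁺ (not i , not j))) (≢-complement p≢c)

  mc⁻ : ∀ {w} c → parity (cell w) ≡ c → ¬ (w ⊩ mc⟨ c ⟩)
  mc⁻ (i , j) p (inj₁ q)        = not-¬ refl (,-injectiveʳ (trans (sym p) (m⁻ (i , not j) q)))
  mc⁻ (i , j) p (inj₂ (inj₁ q)) = not-¬ refl (,-injectiveˡ (trans (sym p) (m⁻ (not i , j) q)))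
  mc⁻ (i , j) p (inj₂ (inj₂ q)) = not-¬ refl (,-injectiveˡ (trans (sym p) (m⁻ (not i , not j) q)))

  tl⁻ : ∀ w {t} → w ⊩ tl t → tileOf w ≡ t
  tl⁻ w = toℕ-injective

  east-neighbour : ∀ u {v} → cell v ≡ step false (cell u) → Any (v ⊩_) (R (tileOf u))
  east-neighbour u {v} moved =
    lose (∈-map⁺ tl (∈-filter⁺ (λ t → tE (T (tileOf u)) ≟ tW (T t)) (∈-allFin (tileOf v)) matches))
         refl
    where
    matches : tE (T (tileOf u)) ≡ tW (T (tileOf v))
    matches = trans (east (proj₁ (cell u)) (proj₂ (cell u)))
                    (cong (tW ∘ T ∘ uncurry tileAt) (sym moved))

  north-neighbour : ∀ u {v} → cell v ≡ step true (cell u) → Any (v ⊩_) (U (tileOf u))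
  north-neighbour u {v} moved =
    lose (∈-map⁺ tl (∈-filter⁺ (λ t → tN (T (tileOf u)) ≟ tS (T t)) (∈-allFin (tileOf v)) matches))
         refl
    where
    matches : tN (T (tileOf u)) ≡ tS (T (tileOf v))
    matches = trans (north (proj₁ (cell u)) (proj₂ (cell u)))
                    (cong (tS ∘ T ∘ uncurry tileAt) (sym moved))

  east-move : ∀ c {u v t} → Moves false u v → u ⊩ m⟨ c ⟩ → u ⊩ tl t →
              v ⊩ orAnd m⟨ c ⟩ m⟨ toggle false c ⟩ (R t)
  east-move c {t = t} (inj₁ refl) u⊩m _ = orAnd-introˡ (R t) u⊩m
  east-move c {u} {v} (inj₂ moved) u⊩m u⊩t =
    orAnd-introʳ _ (m⁺ (toggle false c) (trans (cong parity moved) (cong (toggle false) (m⁻ c u⊩m))))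
      (subst (λ t → Any (v ⊩_) (R t)) (tl⁻ u u⊩t) (east-neighbour u moved))

  north-move : ∀ c {u v t} → Moves true u v → u ⊩ m⟨ c ⟩ → u ⊩ tl t →
               v ⊩ orAnd m⟨ c ⟩ m⟨ toggle true c ⟩ (U t)
  north-move c {t = t} (inj₁ refl) u⊩m _ = orAnd-introˡ (U t) u⊩m
  north-move c {u} {v} (inj₂ moved) u⊩m u⊩t =
    orAnd-introʳ _ (m⁺ (toggle true c) (trans (cong parity moved) (cong (toggle true) (m⁻ c u⊩m))))
      (subst (λ t → Any (v ⊩_) (U t)) (tl⁻ u u⊩t) (north-neighbour u moved))

  x-moves : ∀ {z} → z ⊩ x → ∀ w → Moves false w (z ∪ w)
  x-moves (k , even , refl) w = subst (λ a → Moves a w (⁅ k ⁆ ∪ w)) even (⁅⁆-∪-moves k w)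

  y-moves : ∀ {z} → z ⊩ y → ∀ w → Moves true w (w ∪ z)
  y-moves (k , odd , refl) w = subst₂ (λ a → Moves a w) odd (∪-comm ⁅ k ⁆ w) (⁅⁆-∪-moves k w)

  A1-holds : ∀ {z} → z ⊩ x → All (z ⊩_) A1
  A1-holds {z} z⊩x = concatMap⁺ _ (universal (λ t →
      clause t (false , false) ∷ clause t (false , true) ∷
      clause t (true , false)  ∷ clause t (true , true)  ∷ [])
    idx)
    where
    clause : ∀ t c → z ⊩ (m⟨ c ⟩ ∧ᶠ tl t) ⇒ orAnd m⟨ c ⟩ m⟨ toggle false c ⟩ (R t)
    clause t c u (u⊩m , u⊩t) = east-move c (x-moves z⊩x u) u⊩m u⊩t

  -- bits is a closed list, so A2 normalises completely and its row function cannot be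
  -- inferred; A2-entry spells it out.
  A2-holds : ∀ {z} → All (z ⊩_) A2
  A2-holds {z} = concatMap⁺ (λ c → concatMap (A2-entry c) bits)
    (universal (λ c → concatMap⁺ (A2-entry c) (universal (exclusive c) bits)) bits)
    where
    A2-entry : Bool × Bool → Bool × Bool → List Form
    A2-entry (i , j) (i' , j') =
      if (i xor i') ∨ (j xor j') then ((m i j ∧ᶠ m i' j') ⇒ (m false false ∧ᶠ m false true)) ∷ [] else []
    exclusive : ∀ c c' → All (z ⊩_) (A2-entry c c')
    exclusive c c' = if-[]⁺ _ λ distinct u (p , q) →
      contradiction (trans (sym (m⁻ c p)) (m⁻ c' q)) (xor-distinct distinct)

  A3-holds : ∀ {z} → All (z ⊩_) A3
  A3-holds = concatMap⁺ _ (universal (λ t → concatMap⁺ _ (universal (λ t' →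
    if-does-[]⁺ (t ≟ᶠ t') λ t≢t' u (p , q) → contradiction (trans (sym (tl⁻ u p)) (tl⁻ u q)) t≢t')
    idx)) idx)

  x'-holds : ∀ {z} → z ⊩ x → z ⊩ x'
  x'-holds z⊩x = ∧*-intro {A = x} (p⊤ ∷ (p⊤ ⇒ p⊤) ∷ (A1 ++ A2 ++ A3)) z⊩x
    (tt ∷ (λ _ _ → tt) ∷ ++⁺ (A1-holds z⊩x) (++⁺ A2-holds A3-holds))

  y'-holds : ∀ {z} → z ⊩ y → z ⊩ y'
  y'-holds z⊩y = z⊩y , tt , λ _ _ → tt

  G-holds : ∀ w → w ⊩ G⟨ parity (cell w) ⟩
  G-holds w = m⁺ (parity (cell w)) refl ,
    ⋁-intro _ (lose (∈-map⁺ _ (∈-allFin (tileOf w))) (refl , λ z z⊩y →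
      north-move (parity (cell w)) (y-moves z⊩y w) (m⁺ (parity (cell w)) refl) refl))

  G-any : ∀ {w} c → w ⊩ G⟨ c ⟩ → w ⊩ G false false ∨ᶠ G false true ∨ᶠ G true false ∨ᶠ G true true
  G-any (false , false) ⊩G = inj₁ ⊩G
  G-any (false , true)  ⊩G = inj₂ (inj₁ ⊩G)
  G-any (true  , false) ⊩G = inj₂ (inj₂ (inj₁ ⊩G))
  G-any (true  , true)  ⊩G = inj₂ (inj₂ (inj₂ ⊩G))

  FreshSteps : Bool → Form → Set
  FreshSteps a φ = ∀ w → ∃[ z ] z ⊩ φ × cell (w ∪ z) ≡ step a (cell w)

  x'-fresh : FreshSteps false x'
  x'-fresh w with fresh-singleton false w
  ... | k , even , moved = ⁅ k ⁆ , x'-holds (k , even , refl) , moved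

  y'-fresh : FreshSteps true y'
  y'-fresh w with fresh-singleton true w
  ... | k , odd , moved = ⁅ k ⁆ , y'-holds (k , odd , refl) , moved

  -- Were the parity of u already c, joining a fresh φ-world would toggle it to where
  -- mc⟨ toggle a c ⟩ fails.
  mc-by-fresh-step : ∀ a φ → FreshSteps a φ → ∀ c u → u ⊩ φ ⇒ mc⟨ toggle a c ⟩ → u ⊩ mc⟨ c ⟩
  mc-by-fresh-step a φ fresh c u u⊩φ⇒mc with ≡-dec _≟ᵇ_ _≟ᵇ_ (parity (cell u)) c
  ... | no  p≢c = mc⁺ c p≢c
  ... | yes p≡c with fresh u
  ...   | z , z⊩φ , moved = contradiction (u⊩φ⇒mc z z⊩φ) (mc⁻ (toggle a c) toggled)
    where
    open ≡-Reasoning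
    toggled : parity (cell (u ∪ z)) ≡ toggle a c
    toggled = begin
      parity (cell (u ∪ z))        ≡⟨ cong parity moved ⟩
      parity (step a (cell u))     ≡⟨ parity-step a (cell u) ⟩
      toggle a (parity (cell u))   ≡⟨ cong (toggle a) p≡c ⟩
      toggle a c                   ∎

  antecedent : ∅ ⊩ α ∧ᶠ β₁ ∧ᶠ β₂ ∧ᶠ γ ∧ᶠ G false false
  antecedent =
    ((λ _ h → h) , (λ _ h → h) , (λ _ h → h) , (λ _ h → h)) ,
    (βʸ (false , true) , βʸ (true , false)) ,
    (βˣ (false , false) , βˣ (true , true)) ,
    (λ u _ → G-any (parity (cell u)) (G-holds u)) ,
    G-holds ∅
    where
    βˣ : ∀ c u → u ⊩ x' ⇒ mc⟨ toggle false c ⟩ → u ⊩ mc⟨ c ⟩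
    βˣ = mc-by-fresh-step false x' x'-fresh
    βʸ : ∀ c u → u ⊩ y' ⇒ mc⟨ toggle true c ⟩ → u ⊩ mc⟨ c ⟩
    βʸ = mc-by-fresh-step true y' y'-fresh

  refutes : ¬ (∅ ⊩ ψ)
  refutes ∅⊩ψ = mc⁻ {⁅ 0 ⁆} (true , false) refl (∅⊩ψ ∅ antecedent ⁅ 0 ⁆ (x'-holds (0 , refl , refl)))

-- Tiles are referred to by their position in 𝒲.
lemma5p5 : (𝒲 : List Tile) → Unique 𝒲 → Tiles 𝒲 →
    Σ Valuation (λ V → ¬ (V ⊨ ∅ ⊩ ψ[ 𝒲 ]))
lemma5p5 𝒲 _ tiling = V , refutes
  where open Countermodel 𝒲 (restrictToQuadrant tiling)
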